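{- Let $v$, $k$ and $\lambda$ be positive integers such that $3 \leq k < v$. Suppose that every $(v,k,\lambda)$-packing $\mathcal{D}$ has at least $\alpha|V_0(\mathcal{D})|+\beta|V_1(\mathcal{D})|$ blocks, where $\alpha$ and $\beta$ are nonnegative real numbers such that $\alpha \geq 2\beta$ and $\alpha > \beta+\frac{1}{k}$. Then $D_{\lambda}(v,k) \leq \lfloor DB_{(v,k,\lambda)}(\alpha,\beta) \rfloor$.
   Context: A $(v,k,\lambda)$-packing is a pair $([v],\mathcal{B})$ where $\mathcal{B}$ is a collection of $k$-subsets of $[v]=\{1,\dots,v\}$ (blocks) such that every pair of distinct points lies together in at most $\lambda$ blocks; $D_\lambda(v,k)$ is the maximum number of blocks in such a packing. For a packing $\mathcal{D}$, its leave is the multigraph $G$ on $[v]$ in which edge $uw$ has multiplicity $\lambda-r_{\mathcal{D}}(uw)$, where $r_{\mathcal{D}}(uw)$ is the number of blocks containing both $u$ and $w$. Let $r,d$ be the integers with $\lambda(v-1)=r(k-1)+d$ and $0\le d<k-1$, and for each nonnegative integer $i$ let $V_i(\mathcal{D})=\{u\in[v]:\deg_G(u)=d+i(k-1)\}$ (equivalently, the points lying in exactly $r-i$ blocks). For nonnegative reals $\alpha\ge\beta$ with $\alpha>\beta+\frac1k$, $DB_{(v,k,\lambda)}(\alpha,\beta)=\frac{rv(\alpha-\beta)-\alpha v}{k(\alpha-\beta)-1}$ with $r=\lfloor\frac{\lambda(v-1)}{k-1}\rfloor$.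
   Formalization: The coefficients α and β range over the nonnegative rationals rather than the nonnegative real numbers. -}

module Defs where

open import Data.Nat as ℕ using (ℕ; _∸_)
open import Data.Bool using (Bool; _∧_)
open import Data.Fin using (Fin)
open import Data.Fin.Subset using (Subset; ∣_∣)
open import Data.Fin.Subset.Properties using (_∈?_)
open import Data.List using (List; length; filter; map; allFin)
open import Data.Nat.ListAction using (sum)
open import Data.List.Relation.Unary.All using (All)
open import Data.Fin.Properties as FinP using ()
open import Data.Integer as ℤ using (ℤ; +_)
open import Data.Rational as ℚ using (ℚ; 0ℚ; _÷_; ≢-nonZero)
open import Data.Rational.Properties as ℚP using ()
open import Relation.Nullary using (does; ¬_; yes; no)
open import Relation.Nullary.Decidable using (⌊_⌋)
open import Relation.Binary.PropositionalEquality using (_≡_)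

toℚ : ℕ → ℚ
toℚ n = + n ℚ./ 1

-- A collection of blocks on the point set [v] = Fin v (a multiset: a list,
-- repeated blocks allowed).
Blocks : ℕ → Set
Blocks v = List (Subset v)

pairCount : ∀ {v} → Blocks v → Fin v → Fin v → ℕ
pairCount 𝒟 u w = length (filter (λ B → (u ∈? B) Relation.Nullary.×-dec (w ∈? B)) 𝒟)
  where import Relation.Nullary

IsPacking : (v k λ′ : ℕ) → Blocks v → Set
IsPacking v k λ′ 𝒟 =
  All (λ B → ∣ B ∣ ≡ k) 𝒟 ×
  ((u w : Fin v) → ¬ (u ≡ w) → pairCount 𝒟 u w ℕ.≤ λ′)
  where open import Data.Product using (_×_)

-- degree of u in the leave multigraph G (edge uw has multiplicity λ - r_D(uw))
leaveDeg : ∀ {v} → ℕ → Blocks v → Fin v → ℕ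
leaveDeg {v} λ′ 𝒟 u =
  sum (map (λ w → λ′ ∸ pairCount 𝒟 u w)
           (filter (λ w → Relation.Nullary.¬? (u FinP.≟ w)) (allFin v)))
  where import Relation.Nullary

sizeV : ∀ {v} → (k λ′ d i : ℕ) → Blocks v → ℕ
sizeV {v} k λ′ d i 𝒟 =
  length (filter (λ u → leaveDeg λ′ 𝒟 u ℕ.≟ d ℕ.+ i ℕ.* (k ∸ 1)) (allFin v))

-- total division on ℚ (value 0 when the divisor is 0; only used where the
-- divisor is provably nonzero)
_÷₀_ : ℚ → ℚ → ℚ
p ÷₀ q with q ℚP.≟ 0ℚ
... | yes _ = 0ℚ
... | no q≢0 = _÷_ p q {{≢-nonZero q≢0}}

-- DB_{(v,k,λ)}(α,β) = (r v (α-β) - α v) / (k (α-β) - 1), with r = ⌊λ(v-1)/(k-1)⌋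
DB : (v k r : ℕ) → ℚ → ℚ → ℚ
DB v k r α β =
  ((toℚ r ℚ.* toℚ v ℚ.* (α ℚ.- β)) ℚ.- (α ℚ.* toℚ v))
    ÷₀ ((toℚ k ℚ.* (α ℚ.- β)) ℚ.- ℚ.1ℚ)

{-# OPTIONS --safe #-}

-- A point u lying in ρ(u) blocks has leave degree λ(v-1) - (k-1)ρ(u); comparing with
-- λ(v-1) = r(k-1) + d, d < k-1, gives ρ(u) ≤ r and leave degree d + (r - ρ(u))(k-1),
-- so u ∈ V_i exactly when its deficiency r - ρ(u) is i.  Double counting the incidences
-- of the b blocks,
--   k b = Σ ρ(u) = r v - Σ (r - ρ(u)) ≤ r v - 2v + 2|V₀| + |V₁|,   and   |V₀| + |V₁| ≤ v.
-- Adding α - β times the first, α - 2β times the second and the hypothesis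
-- b ≥ α|V₀| + β|V₁| eliminates |V₀| and |V₁|, leaving (k(α-β) - 1) b ≤ r v (α-β) - α v,
-- where k(α-β) - 1 > 0 because α > β + 1/k.

module Submission where

open import Defs
open import Data.Nat as ℕ
  using (ℕ; zero; suc; _+_; _*_; _∸_; _≤_; _<_; z≤n; s≤s; NonZero; >-nonZero)
import Data.Nat.Properties as ℕP
import Data.Nat.Coprimality as Coprimality
open import Data.Nat.ListAction using (sum)
open import Data.Nat.Solver using (module +-*-Solver)
open import Data.Integer as ℤ using (+_)
import Data.Integer.Properties as ℤP
import Data.Integer.DivMod as ℤD
open import Data.Rational as ℚ using (ℚ; mkℚ; 0ℚ; 1ℚ; floor)
import Data.Rational.Properties as ℚP
import Data.Rational.Solver as ℚSolver
open import Data.Bool using (true; false; if_then_else_)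
open import Data.Empty using (⊥-elim)
open import Data.Product using (_,_; proj₁)
open import Data.List using (List; []; _∷_; map; filter; allFin; length)
open import Data.List.Properties using (map-tabulate; length-tabulate; filter-≐)
open import Data.List.Relation.Unary.All using (All; []; _∷_)
open import Data.List.Relation.Unary.All.Properties using (all-filter)
open import Data.Fin using (Fin; zero; suc)
open import Data.Fin.Properties using (_≟_)
open import Data.Fin.Subset using (Subset; ∣_∣)
open import Data.Fin.Subset.Properties using (_∈?_)
import Data.Vec as Vec
open import Function using (_∘_; id)
open import Relation.Nullary using (Dec; does; _because_; yes; no; ¬?; _×-dec_)
open import Relation.Unary using (Pred; Decidable)
open import Relation.Binary.PropositionalEquality
open import Algebra.Properties.CommutativeSemigroup ℕP.+-commutativeSemigroup using (interchange)

-- Going through `does` makes 𝟙 independent of the proposition, so that for instance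
-- 𝟙 (suc u ≟ suc w) and 𝟙 (u ≟ w) are definitionally equal.
𝟙 : ∀ {p} {P : Set p} → Dec P → ℕ
𝟙 P? = if does P? then 1 else 0

𝟙-+-𝟙¬ : ∀ {p} {P : Set p} (P? : Dec P) → 𝟙 P? + 𝟙 (¬? P?) ≡ 1
𝟙-+-𝟙¬ (true  because _) = refl
𝟙-+-𝟙¬ (false because _) = refl

𝟙-×-dec : ∀ {p q} {P : Set p} {Q : Set q} (P? : Dec P) (Q? : Dec Q) → 𝟙 (P? ×-dec Q?) ≡ 𝟙 P? * 𝟙 Q?
𝟙-×-dec (true  because _) (true  because _) = refl
𝟙-×-dec (true  because _) (false because _) = refl
𝟙-×-dec (false because _) _                 = refl

𝟙-idem : ∀ {p} {P : Set p} (P? : Dec P) → 𝟙 P? * 𝟙 P? ≡ 𝟙 P?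
𝟙-idem (true  because _) = refl
𝟙-idem (false because _) = refl

∑ : ∀ {a} {A : Set a} → List A → (A → ℕ) → ℕ
∑ xs f = sum (map f xs)

syntax ∑ xs (λ x → e) = ∑[ x ∈ xs ] e

module _ {a} {A : Set a} where

  ∑-cong : ∀ (xs : List A) {f g : A → ℕ} → (∀ x → f x ≡ g x) → ∑ xs f ≡ ∑ xs g
  ∑-cong []       f≗g = refl
  ∑-cong (x ∷ xs) f≗g = cong₂ _+_ (f≗g x) (∑-cong xs f≗g)

  ∑-congᴬ : ∀ {p} {P : Pred A p} {xs : List A} {f g : A → ℕ} →
            All P xs → (∀ {x} → P x → f x ≡ g x) → ∑ xs f ≡ ∑ xs g
  ∑-congᴬ []         f≗g = refl
  ∑-congᴬ (px ∷ pxs) f≗g = cong₂ _+_ (f≗g px) (∑-congᴬ pxs f≗g)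

  ∑-mono-≤ : ∀ (xs : List A) {f g : A → ℕ} → (∀ x → f x ≤ g x) → ∑ xs f ≤ ∑ xs g
  ∑-mono-≤ []       f≤g = z≤n
  ∑-mono-≤ (x ∷ xs) f≤g = ℕP.+-mono-≤ (f≤g x) (∑-mono-≤ xs f≤g)

  ∑-distrib-+ : ∀ (xs : List A) (f g : A → ℕ) →
                ∑[ x ∈ xs ] (f x + g x) ≡ ∑ xs f + ∑ xs g
  ∑-distrib-+ []       f g = refl
  ∑-distrib-+ (x ∷ xs) f g =
    trans (cong (λ s → f x + g x + s) (∑-distrib-+ xs f g)) (interchange (f x) (g x) _ _)

  *-distribˡ-∑ : ∀ (xs : List A) c (f : A → ℕ) → c * ∑ xs f ≡ ∑[ x ∈ xs ] (c * f x)
  *-distribˡ-∑ []       c f = ℕP.*-zeroʳ c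
  *-distribˡ-∑ (x ∷ xs) c f =
    trans (ℕP.*-distribˡ-+ c (f x) _) (cong (λ s → c * f x + s) (*-distribˡ-∑ xs c f))

  ∑-const : ∀ (xs : List A) c → ∑[ _ ∈ xs ] c ≡ c * length xs
  ∑-const []       c = sym (ℕP.*-zeroʳ c)
  ∑-const (x ∷ xs) c = trans (cong (_+_ c) (∑-const xs c)) (sym (ℕP.*-suc c (length xs)))

  ∑-1 : ∀ (xs : List A) → ∑[ _ ∈ xs ] 1 ≡ length xs
  ∑-1 xs = trans (∑-const xs 1) (ℕP.*-identityˡ (length xs))

  ∑-filter : ∀ {p} {P : Pred A p} (P? : Decidable P) (xs : List A) (f : A → ℕ) →
             ∑ (filter P? xs) f ≡ ∑[ x ∈ xs ] (𝟙 (P? x) * f x)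
  ∑-filter P? []       f = refl
  ∑-filter P? (x ∷ xs) f with P? x
  ... | true  because _ = cong₂ _+_ (sym (ℕP.+-identityʳ (f x))) (∑-filter P? xs f)
  ... | false because _ = ∑-filter P? xs f

  length-filter≡∑𝟙 : ∀ {p} {P : Pred A p} (P? : Decidable P) (xs : List A) →
                     length (filter P? xs) ≡ ∑[ x ∈ xs ] 𝟙 (P? x)
  length-filter≡∑𝟙 P? xs = begin
    length (filter P? xs)          ≡⟨ ∑-1 (filter P? xs) ⟨
    ∑ (filter P? xs) (λ _ → 1)     ≡⟨ ∑-filter P? xs (λ _ → 1) ⟩
    ∑[ x ∈ xs ] (𝟙 (P? x) * 1)     ≡⟨ ∑-cong xs (λ x → ℕP.*-identityʳ (𝟙 (P? x))) ⟩
    ∑[ x ∈ xs ] 𝟙 (P? x)           ∎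
    where open ≡-Reasoning

∑-comm : ∀ {a b} {A : Set a} {B : Set b} (xs : List A) (ys : List B) (f : A → B → ℕ) →
         ∑[ x ∈ xs ] ∑ ys (f x) ≡ ∑[ y ∈ ys ] ∑[ x ∈ xs ] f x y
∑-comm []       ys f = sym (trans (∑-const ys 0) (ℕP.*-zeroˡ (length ys)))
∑-comm (x ∷ xs) ys f =
  trans (cong (λ s → ∑ ys (f x) + s) (∑-comm xs ys f)) (sym (∑-distrib-+ ys (f x) _))

∑-allFin-suc : ∀ n (f : Fin (suc n) → ℕ) → ∑ (allFin (suc n)) f ≡ f zero + ∑ (allFin n) (f ∘ suc)
∑-allFin-suc n f = cong (λ fs → f zero + sum fs)
  (trans (map-tabulate suc f) (sym (map-tabulate id (f ∘ suc))))

length-allFin : ∀ n → length (allFin n) ≡ n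
length-allFin n = length-tabulate id

∑-allFin-const : ∀ n c → ∑[ _ ∈ allFin n ] c ≡ c * n
∑-allFin-const n c = trans (∑-const (allFin n) c) (cong (c *_) (length-allFin n))

∑-allFin-δ : ∀ n (u : Fin n) (f : Fin n → ℕ) → ∑[ w ∈ allFin n ] (𝟙 (u ≟ w) * f w) ≡ f u
∑-allFin-δ (suc n) zero f = begin
  ∑[ w ∈ allFin (suc n) ] (𝟙 (zero ≟ w) * f w)
    ≡⟨ ∑-allFin-suc n (λ w → 𝟙 (zero ≟ w) * f w) ⟩
  f zero + 0 + ∑[ _ ∈ allFin n ] 0
    ≡⟨ cong₂ _+_ (ℕP.+-identityʳ (f zero)) (∑-const (allFin n) 0) ⟩
  f zero + 0
    ≡⟨ ℕP.+-identityʳ (f zero) ⟩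
  f zero
    ∎
  where open ≡-Reasoning
∑-allFin-δ (suc n) (suc u) f =
  trans (∑-allFin-suc n (λ w → 𝟙 (suc u ≟ w) * f w)) (∑-allFin-δ n u (f ∘ suc))

∑-allFin-∈ : ∀ n (B : Subset n) → ∑[ w ∈ allFin n ] 𝟙 (w ∈? B) ≡ ∣ B ∣
∑-allFin-∈ zero    Vec.[]          = refl
∑-allFin-∈ (suc n) B@(true Vec.∷ B′) =
  trans (∑-allFin-suc n (λ w → 𝟙 (w ∈? B))) (cong suc (∑-allFin-∈ n B′))
∑-allFin-∈ (suc n) B@(false Vec.∷ B′) =
  trans (∑-allFin-suc n (λ w → 𝟙 (w ∈? B))) (∑-allFin-∈ n B′)

others : ∀ {n} → Fin n → List (Fin n)
others {n} u = filter (λ w → ¬? (u ≟ w)) (allFin n)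

∑-allFin-split : ∀ {n} (u : Fin n) (f : Fin n → ℕ) → ∑ (allFin n) f ≡ f u + ∑ (others u) f
∑-allFin-split {n} u f = begin
  ∑ (allFin n) f
    ≡⟨ ∑-cong (allFin n) (λ w → trans (sym (ℕP.*-identityˡ (f w)))
                                      (cong (_* f w) (sym (𝟙-+-𝟙¬ (u ≟ w))))) ⟩
  ∑[ w ∈ allFin n ] ((𝟙 (u ≟ w) + 𝟙 (¬? (u ≟ w))) * f w)
    ≡⟨ ∑-cong (allFin n) (λ w → ℕP.*-distribʳ-+ (f w) (𝟙 (u ≟ w)) _) ⟩
  ∑[ w ∈ allFin n ] (𝟙 (u ≟ w) * f w + 𝟙 (¬? (u ≟ w)) * f w)
    ≡⟨ ∑-distrib-+ (allFin n) _ _ ⟩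
  ∑[ w ∈ allFin n ] (𝟙 (u ≟ w) * f w) + ∑[ w ∈ allFin n ] (𝟙 (¬? (u ≟ w)) * f w)
    ≡⟨ cong₂ _+_ (∑-allFin-δ n u f) (sym (∑-filter (λ w → ¬? (u ≟ w)) (allFin n) f)) ⟩
  f u + ∑ (others u) f
    ∎
  where open ≡-Reasoning

length-others : ∀ {n} (u : Fin n) → length (others u) ≡ n ∸ 1
length-others {n} u = cong (_∸ 1) (begin
  suc (length (others u))             ≡⟨ cong suc (∑-1 (others u)) ⟨
  1 + ∑[ _ ∈ others u ] 1              ≡⟨ ∑-allFin-split u (λ _ → 1) ⟨
  ∑[ _ ∈ allFin n ] 1                  ≡⟨ ∑-1 (allFin n) ⟩
  length (allFin n)                    ≡⟨ length-allFin n ⟩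
  n                                    ∎)
  where open ≡-Reasoning

module _ {e m q r d : ℕ} (d<m : d < m) (eq : e + m * q ≡ r * m + d) where

  e+m*q≡r*m+d⇒q≤r : q ≤ r
  e+m*q≡r*m+d⇒q≤r = ℕP.≮⇒≥ (λ r<q → ℕP.<-irrefl (sym eq) (begin-strict
    r * m + d      <⟨ ℕP.+-monoʳ-< (r * m) d<m ⟩
    r * m + m      ≡⟨ ℕP.+-comm (r * m) m ⟩
    suc r * m      ≤⟨ ℕP.*-monoˡ-≤ m r<q ⟩
    q * m          ≡⟨ ℕP.*-comm q m ⟩
    m * q          ≤⟨ ℕP.m≤n+m (m * q) e ⟩
    e + m * q      ∎))
    where open ℕP.≤-Reasoning

  e+m*q≡r*m+d⇒e≡d+[r∸q]*m : e ≡ d + (r ∸ q) * m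
  e+m*q≡r*m+d⇒e≡d+[r∸q]*m = ℕP.+-cancelʳ-≡ (m * q) e (d + (r ∸ q) * m) (begin
    e + m * q                  ≡⟨ eq ⟩
    r * m + d                  ≡⟨ cong (λ r → r * m + d) (ℕP.m∸n+n≡m e+m*q≡r*m+d⇒q≤r) ⟨
    (r ∸ q + q) * m + d        ≡⟨ rearrange (r ∸ q) q m d ⟩
    d + (r ∸ q) * m + m * q    ∎)
    where
    open ≡-Reasoning
    open +-*-Solver
    rearrange : ∀ a q m d → (a + q) * m + d ≡ d + a * m + m * q
    rearrange = solve 4 (λ a q m d → (a :+ q) :* m :+ d := d :+ a :* m :+ m :* q) refl

replication : ∀ {v} → Blocks v → Fin v → ℕ
replication 𝒟 u = ∑[ B ∈ 𝒟 ] 𝟙 (u ∈? B)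

module _ {v} (𝒟 : Blocks v) where

  pairCount≡∑ : ∀ u w → pairCount 𝒟 u w ≡ ∑[ B ∈ 𝒟 ] (𝟙 (u ∈? B) * 𝟙 (w ∈? B))
  pairCount≡∑ u w = trans (length-filter≡∑𝟙 _ 𝒟) (∑-cong 𝒟 (λ B → 𝟙-×-dec (u ∈? B) (w ∈? B)))

  pairCount-diag : ∀ u → pairCount 𝒟 u u ≡ replication 𝒟 u
  pairCount-diag u = trans (pairCount≡∑ u u) (∑-cong 𝒟 (λ B → 𝟙-idem (u ∈? B)))

module _ {v k} {𝒟 : Blocks v} (uniform : All (λ B → ∣ B ∣ ≡ k) 𝒟) where

  ∑-replication : ∑ (allFin v) (replication 𝒟) ≡ k * length 𝒟
  ∑-replication = begin
    ∑[ u ∈ allFin v ] ∑[ B ∈ 𝒟 ] 𝟙 (u ∈? B)   ≡⟨ ∑-comm (allFin v) 𝒟 (λ u B → 𝟙 (u ∈? B)) ⟩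
    ∑[ B ∈ 𝒟 ] ∑[ u ∈ allFin v ] 𝟙 (u ∈? B)   ≡⟨ ∑-cong 𝒟 (∑-allFin-∈ v) ⟩
    ∑[ B ∈ 𝒟 ] ∣ B ∣                           ≡⟨ ∑-congᴬ uniform (λ |B|≡k → |B|≡k) ⟩
    ∑[ _ ∈ 𝒟 ] k                               ≡⟨ ∑-const 𝒟 k ⟩
    k * length 𝒟                               ∎
    where open ≡-Reasoning

  ∑-pairCount : ∀ u → ∑ (allFin v) (pairCount 𝒟 u) ≡ k * replication 𝒟 u
  ∑-pairCount u = begin
    ∑ (allFin v) (pairCount 𝒟 u)
      ≡⟨ ∑-cong (allFin v) (pairCount≡∑ 𝒟 u) ⟩
    ∑[ w ∈ allFin v ] ∑[ B ∈ 𝒟 ] (𝟙 (u ∈? B) * 𝟙 (w ∈? B))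
      ≡⟨ ∑-comm (allFin v) 𝒟 (λ w B → 𝟙 (u ∈? B) * 𝟙 (w ∈? B)) ⟩
    ∑[ B ∈ 𝒟 ] ∑[ w ∈ allFin v ] (𝟙 (u ∈? B) * 𝟙 (w ∈? B))
      ≡⟨ ∑-cong 𝒟 (λ B → sym (*-distribˡ-∑ (allFin v) (𝟙 (u ∈? B)) (λ w → 𝟙 (w ∈? B)))) ⟩
    ∑[ B ∈ 𝒟 ] (𝟙 (u ∈? B) * ∑[ w ∈ allFin v ] 𝟙 (w ∈? B))
      ≡⟨ ∑-cong 𝒟 (λ B → cong (𝟙 (u ∈? B) *_) (∑-allFin-∈ v B)) ⟩
    ∑[ B ∈ 𝒟 ] (𝟙 (u ∈? B) * ∣ B ∣)
      ≡⟨ ∑-congᴬ uniform (λ {B} |B|≡k → trans (cong (𝟙 (u ∈? B) *_) |B|≡k) (ℕP.*-comm _ k)) ⟩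
    ∑[ B ∈ 𝒟 ] (k * 𝟙 (u ∈? B))
      ≡⟨ *-distribˡ-∑ 𝒟 k (λ B → 𝟙 (u ∈? B)) ⟨
    k * replication 𝒟 u
      ∎
    where open ≡-Reasoning

  ∑-others-pairCount : ∀ u → ∑ (others u) (pairCount 𝒟 u) ≡ (k ∸ 1) * replication 𝒟 u
  ∑-others-pairCount u = begin
    ∑ (others u) (pairCount 𝒟 u)             ≡⟨ ℕP.m+n∸m≡n ρ _ ⟨
    ρ + ∑ (others u) (pairCount 𝒟 u) ∸ ρ     ≡⟨ cong (_∸ ρ) splitOff ⟩
    k * ρ ∸ ρ                                ≡⟨ cong (k * ρ ∸_) (ℕP.*-identityˡ ρ) ⟨
    k * ρ ∸ 1 * ρ                            ≡⟨ ℕP.*-distribʳ-∸ ρ k 1 ⟨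
    (k ∸ 1) * ρ                              ∎
    where
    open ≡-Reasoning
    ρ = replication 𝒟 u
    splitOff : ρ + ∑ (others u) (pairCount 𝒟 u) ≡ k * ρ
    splitOff = begin
      ρ + ∑ (others u) (pairCount 𝒟 u)
        ≡⟨ cong (_+ ∑ (others u) (pairCount 𝒟 u)) (pairCount-diag 𝒟 u) ⟨
      pairCount 𝒟 u u + ∑ (others u) (pairCount 𝒟 u)
        ≡⟨ ∑-allFin-split u (pairCount 𝒟 u) ⟨
      ∑ (allFin v) (pairCount 𝒟 u)
        ≡⟨ ∑-pairCount u ⟩
      k * ρ
        ∎

leaveDeg+[k∸1]*replication : ∀ {v k λ′} {𝒟 : Blocks v} → IsPacking v k λ′ 𝒟 →
  ∀ u → leaveDeg λ′ 𝒟 u + (k ∸ 1) * replication 𝒟 u ≡ λ′ * (v ∸ 1)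
leaveDeg+[k∸1]*replication {v} {k} {λ′} {𝒟} (uniform , λ-bound) u = begin
  leaveDeg λ′ 𝒟 u + (k ∸ 1) * replication 𝒟 u
    ≡⟨ cong (λ s → leaveDeg λ′ 𝒟 u + s) (∑-others-pairCount uniform u) ⟨
  ∑[ w ∈ others u ] (λ′ ∸ pairCount 𝒟 u w) + ∑ (others u) (pairCount 𝒟 u)
    ≡⟨ ∑-distrib-+ (others u) (λ w → λ′ ∸ pairCount 𝒟 u w) (pairCount 𝒟 u) ⟨
  ∑[ w ∈ others u ] (λ′ ∸ pairCount 𝒟 u w + pairCount 𝒟 u w)
    ≡⟨ ∑-congᴬ (all-filter _ (allFin v)) (λ {w} u≢w → ℕP.m∸n+n≡m (λ-bound u w u≢w)) ⟩
  ∑[ _ ∈ others u ] λ′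
    ≡⟨ ∑-const (others u) λ′ ⟩
  λ′ * length (others u)
    ≡⟨ cong (λ′ *_) (length-others u) ⟩
  λ′ * (v ∸ 1)
    ∎
  where open ≡-Reasoning

2≤n+2[n≡0]+[n≡1] : ∀ n → 2 ≤ n + (2 * 𝟙 (n ℕ.≟ 0) + 𝟙 (n ℕ.≟ 1))
2≤n+2[n≡0]+[n≡1] 0             = ℕP.≤-refl
2≤n+2[n≡0]+[n≡1] 1             = ℕP.≤-refl
2≤n+2[n≡0]+[n≡1] (suc (suc n)) = s≤s (s≤s z≤n)

[n≡0]+[n≡1]≤1 : ∀ n → 𝟙 (n ℕ.≟ 0) + 𝟙 (n ℕ.≟ 1) ≤ 1
[n≡0]+[n≡1]≤1 0             = ℕP.≤-refl
[n≡0]+[n≡1]≤1 1             = ℕP.≤-refl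
[n≡0]+[n≡1]≤1 (suc (suc n)) = z≤n

module Deficiency {v k λ′ r d : ℕ} {𝒟 : Blocks v} (packing : IsPacking v k λ′ 𝒟)
  (division : λ′ * (v ∸ 1) ≡ r * (k ∸ 1) + d) (d<k∸1 : d < k ∸ 1) where

  deficiency : Fin v → ℕ
  deficiency u = r ∸ replication 𝒟 u

  private
    leaveDeg-division : ∀ u → leaveDeg λ′ 𝒟 u + (k ∸ 1) * replication 𝒟 u ≡ r * (k ∸ 1) + d
    leaveDeg-division u = trans (leaveDeg+[k∸1]*replication packing u) division

  replication+deficiency≡r : ∀ u → replication 𝒟 u + deficiency u ≡ r
  replication+deficiency≡r u = ℕP.m+[n∸m]≡n (e+m*q≡r*m+d⇒q≤r d<k∸1 (leaveDeg-division u))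

  leaveDeg≡d+deficiency*[k∸1] : ∀ u → leaveDeg λ′ 𝒟 u ≡ d + deficiency u * (k ∸ 1)
  leaveDeg≡d+deficiency*[k∸1] u = e+m*q≡r*m+d⇒e≡d+[r∸q]*m d<k∸1 (leaveDeg-division u)

  sizeV≡∑[deficiency≡i] : ∀ i → sizeV k λ′ d i 𝒟 ≡ ∑[ u ∈ allFin v ] 𝟙 (deficiency u ℕ.≟ i)
  sizeV≡∑[deficiency≡i] i =
    trans (cong length (filter-≐ _ deficiency≟i (leaveDeg⇒deficiency , deficiency⇒leaveDeg)
                                 (allFin v)))
          (length-filter≡∑𝟙 deficiency≟i (allFin v))
    where
    instance
      k∸1≢0 : NonZero (k ∸ 1)
      k∸1≢0 = >-nonZero (ℕP.≤-<-trans z≤n d<k∸1)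
    deficiency≟i : ∀ u → Dec (deficiency u ≡ i)
    deficiency≟i u = deficiency u ℕ.≟ i
    leaveDeg⇒deficiency : ∀ {u} → leaveDeg λ′ 𝒟 u ≡ d + i * (k ∸ 1) → deficiency u ≡ i
    leaveDeg⇒deficiency {u} eq = ℕP.*-cancelʳ-≡ (deficiency u) i (k ∸ 1)
      (ℕP.+-cancelˡ-≡ d _ _ (trans (sym (leaveDeg≡d+deficiency*[k∸1] u)) eq))
    deficiency⇒leaveDeg : ∀ {u} → deficiency u ≡ i → leaveDeg λ′ 𝒟 u ≡ d + i * (k ∸ 1)
    deficiency⇒leaveDeg {u} refl = leaveDeg≡d+deficiency*[k∸1] u

  private
    ∣V₀∣ ∣V₁∣ : ℕ
    ∣V₀∣ = sizeV k λ′ d 0 𝒟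
    ∣V₁∣ = sizeV k λ′ d 1 𝒟
    [deficiency≡_] : ℕ → Fin v → ℕ
    [deficiency≡ i ] u = 𝟙 (deficiency u ℕ.≟ i)

  k*∣𝒟∣+2*v≤r*v+2*∣V₀∣+∣V₁∣ : k * length 𝒟 + 2 * v ≤ r * v + (2 * ∣V₀∣ + ∣V₁∣)
  k*∣𝒟∣+2*v≤r*v+2*∣V₀∣+∣V₁∣ = begin
    k * length 𝒟 + 2 * v
      ≡⟨ cong₂ _+_ (∑-replication (proj₁ packing)) (∑-allFin-const v 2) ⟨
    ∑ (allFin v) (replication 𝒟) + ∑[ _ ∈ allFin v ] 2
      ≡⟨ ∑-distrib-+ (allFin v) (replication 𝒟) (λ _ → 2) ⟨
    ∑[ u ∈ allFin v ] (replication 𝒟 u + 2)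
      ≤⟨ ∑-mono-≤ (allFin v) pointwise ⟩
    ∑[ u ∈ allFin v ] (r + (2 * [deficiency≡ 0 ] u + [deficiency≡ 1 ] u))
      ≡⟨ ∑-distrib-+ (allFin v) (λ _ → r) _ ⟩
    ∑[ _ ∈ allFin v ] r + ∑[ u ∈ allFin v ] (2 * [deficiency≡ 0 ] u + [deficiency≡ 1 ] u)
      ≡⟨ cong₂ _+_ (∑-allFin-const v r) (∑-distrib-+ (allFin v) _ _) ⟩
    r * v + (∑[ u ∈ allFin v ] (2 * [deficiency≡ 0 ] u) + ∑ (allFin v) [deficiency≡ 1 ])
      ≡⟨ cong (λ z → r * v + (z + ∑ (allFin v) [deficiency≡ 1 ]))
              (*-distribˡ-∑ (allFin v) 2 [deficiency≡ 0 ]) ⟨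
    r * v + (2 * ∑ (allFin v) [deficiency≡ 0 ] + ∑ (allFin v) [deficiency≡ 1 ])
      ≡⟨ cong₂ (λ x y → r * v + (2 * x + y)) (sizeV≡∑[deficiency≡i] 0) (sizeV≡∑[deficiency≡i] 1) ⟨
    r * v + (2 * ∣V₀∣ + ∣V₁∣)
      ∎
    where
    open ℕP.≤-Reasoning
    pointwise : ∀ u → replication 𝒟 u + 2 ≤ r + (2 * [deficiency≡ 0 ] u + [deficiency≡ 1 ] u)
    pointwise u = begin
      replication 𝒟 u + 2
        ≤⟨ ℕP.+-monoʳ-≤ (replication 𝒟 u) (2≤n+2[n≡0]+[n≡1] (deficiency u)) ⟩
      replication 𝒟 u + (deficiency u + (2 * [deficiency≡ 0 ] u + [deficiency≡ 1 ] u))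
        ≡⟨ ℕP.+-assoc (replication 𝒟 u) (deficiency u) _ ⟨
      replication 𝒟 u + deficiency u + (2 * [deficiency≡ 0 ] u + [deficiency≡ 1 ] u)
        ≡⟨ cong (_+ (2 * [deficiency≡ 0 ] u + [deficiency≡ 1 ] u)) (replication+deficiency≡r u) ⟩
      r + (2 * [deficiency≡ 0 ] u + [deficiency≡ 1 ] u)
        ∎

  ∣V₀∣+∣V₁∣≤v : ∣V₀∣ + ∣V₁∣ ≤ v
  ∣V₀∣+∣V₁∣≤v = begin
    ∣V₀∣ + ∣V₁∣
      ≡⟨ cong₂ _+_ (sizeV≡∑[deficiency≡i] 0) (sizeV≡∑[deficiency≡i] 1) ⟩
    ∑ (allFin v) [deficiency≡ 0 ] + ∑ (allFin v) [deficiency≡ 1 ]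
      ≡⟨ ∑-distrib-+ (allFin v) [deficiency≡ 0 ] [deficiency≡ 1 ] ⟨
    ∑[ u ∈ allFin v ] ([deficiency≡ 0 ] u + [deficiency≡ 1 ] u)
      ≤⟨ ∑-mono-≤ (allFin v) (λ u → [n≡0]+[n≡1]≤1 (deficiency u)) ⟩
    ∑[ _ ∈ allFin v ] 1
      ≡⟨ ∑-allFin-const v 1 ⟩
    1 * v
      ≡⟨ ℕP.*-identityˡ v ⟩
    v ∎
    where open ℕP.≤-Reasoning

toℚ≡mkℚ : ∀ n → toℚ n ≡ mkℚ (+ n) 0 (Coprimality.sym (Coprimality.1-coprimeTo n))
toℚ≡mkℚ n = ℚP.normalize-coprime (Coprimality.sym (Coprimality.1-coprimeTo n))

toℚ-+ : ∀ m n → toℚ (m ℕ.+ n) ≡ toℚ m ℚ.+ toℚ n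
toℚ-+ m n rewrite toℚ≡mkℚ m | toℚ≡mkℚ n =
  ℚP./-cong (sym (cong₂ ℤ._+_ (ℤP.*-identityʳ (+ m)) (ℤP.*-identityʳ (+ n)))) refl

toℚ-* : ∀ m n → toℚ (m ℕ.* n) ≡ toℚ m ℚ.* toℚ n
toℚ-* m n rewrite toℚ≡mkℚ m | toℚ≡mkℚ n = ℚP./-cong (ℤP.pos-* m n) refl

toℚ-mono-≤ : ∀ {m n} → m ℕ.≤ n → toℚ m ℚ.≤ toℚ n
toℚ-mono-≤ {m} {n} m≤n rewrite toℚ≡mkℚ m | toℚ≡mkℚ n =
  ℚ.*≤* (ℤP.*-monoʳ-≤-nonNeg (+ 1) (ℤ.+≤+ m≤n))

toℚ-mono-< : ∀ {m n} → m ℕ.< n → toℚ m ℚ.< toℚ n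
toℚ-mono-< {m} {n} m<n rewrite toℚ≡mkℚ m | toℚ≡mkℚ n =
  ℚ.*<* (ℤP.*-monoʳ-<-pos (+ 1) (ℤ.+<+ m<n))

i*d≤n⇒i≤n/ℕd : ∀ {i n} d .{{_ : ℕ.NonZero d}} → i ℤ.* + d ℤ.≤ n → i ℤ.≤ n ℤ./ℕ d
i*d≤n⇒i≤n/ℕd {i} {n} d i*d≤n = ℤP.≮⇒≥ λ n/d<i → ℤP.<-irrefl refl (begin-strict
  n                          <⟨ ℤD.n<s[n/ℕd]*d n d ⟩
  ℤ.suc (n ℤ./ℕ d) ℤ.* + d   ≤⟨ ℤP.*-monoʳ-≤-nonNeg (+ d) (ℤP.i<j⇒suc[i]≤j n/d<i) ⟩
  i ℤ.* + d                  ≤⟨ i*d≤n ⟩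
  n                          ∎)
  where open ℤP.≤-Reasoning

toℚ≤q⇒≤floor : ∀ n q → toℚ n ℚ.≤ q → + n ℤ.≤ floor q
toℚ≤q⇒≤floor n q@(mkℚ num den-1 _) n≤q with subst (ℚ._≤ q) (toℚ≡mkℚ n) n≤q
... | ℚ.*≤* n*den≤num = subst (+ n ℤ.≤_) (sym (ℤD.div-pos-is-/ℕ num (suc den-1)))
  (i*d≤n⇒i≤n/ℕd (suc den-1) (subst (+ n ℤ.* + suc den-1 ℤ.≤_) (ℤP.*-identityʳ num) n*den≤num))

p≤q⇒0≤q-p : ∀ {p q} → p ℚ.≤ q → 0ℚ ℚ.≤ q ℚ.- p
p≤q⇒0≤q-p {p} {q} p≤q = subst (ℚ._≤ q ℚ.- p) (ℚP.+-inverseʳ p) (ℚP.+-monoˡ-≤ (ℚ.- p) p≤q)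

p<q⇒0<q-p : ∀ {p q} → p ℚ.< q → 0ℚ ℚ.< q ℚ.- p
p<q⇒0<q-p {p} {q} p<q = subst (ℚ._< q ℚ.- p) (ℚP.+-inverseʳ p) (ℚP.+-monoˡ-< (ℚ.- p) p<q)

0≤q-p⇒p≤q : ∀ {p q} → 0ℚ ℚ.≤ q ℚ.- p → p ℚ.≤ q
0≤q-p⇒p≤q {p} {q} 0≤q-p = subst₂ ℚ._≤_ (ℚP.+-identityˡ p) (q-p+p≡q p q) (ℚP.+-monoˡ-≤ p 0≤q-p)
  where
  open ℚSolver.+-*-Solver
  q-p+p≡q : ∀ p q → q ℚ.- p ℚ.+ p ≡ q
  q-p+p≡q = solve 2 (λ p q → q :- p :+ p := q) refl

0≤p*q : ∀ {p q} → 0ℚ ℚ.≤ p → 0ℚ ℚ.≤ q → 0ℚ ℚ.≤ p ℚ.* q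
0≤p*q {p} {q} 0≤p 0≤q = ℚP.nonNegative⁻¹ (p ℚ.* q)
  {{ℚP.nonNeg*nonNeg⇒nonNeg p {{ℚ.nonNegative 0≤p}} q {{ℚ.nonNegative 0≤q}}}}

÷₀-*-cancel : ∀ p q → q ≢ 0ℚ → (p ÷₀ q) ℚ.* q ≡ p
÷₀-*-cancel p q q≢0 with q ℚP.≟ 0ℚ
... | yes q≡0 = ⊥-elim (q≢0 q≡0)
... | no  q≢0 = begin
  p ℚ.* ℚ.1/ q ℚ.* q     ≡⟨ ℚP.*-assoc p (ℚ.1/ q) q ⟩
  p ℚ.* (ℚ.1/ q ℚ.* q)   ≡⟨ cong (p ℚ.*_) (ℚP.*-inverseˡ q) ⟩
  p ℚ.* 1ℚ               ≡⟨ ℚP.*-identityʳ p ⟩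
  p                      ∎
  where
  open ≡-Reasoning
  instance _ = ℚ.≢-nonZero q≢0

q*p≤n⇒p≤n÷₀q : ∀ {p q n} → 0ℚ ℚ.< q → q ℚ.* p ℚ.≤ n → p ℚ.≤ n ÷₀ q
q*p≤n⇒p≤n÷₀q {p} {q} {n} 0<q q*p≤n = ℚP.*-cancelʳ-≤-pos q {{ℚ.positive 0<q}}
  (subst₂ ℚ._≤_ (ℚP.*-comm q p) (sym (÷₀-*-cancel n q (≢-sym (ℚP.<⇒≢ 0<q)))) q*p≤n)

DB-denominator-pos : ∀ {K α β} → 0ℚ ℚ.< K → β ℚ.+ (toℚ 1 ÷₀ K) ℚ.< α →
                     0ℚ ℚ.< K ℚ.* (α ℚ.- β) ℚ.- 1ℚ
DB-denominator-pos {K} {α} {β} 0<K gap = subst (0ℚ ℚ.<_) K[α-[β+c]]≡K[α-β]-1 0<K[α-[β+c]]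
  where
  open ℚSolver.+-*-Solver
  c = toℚ 1 ÷₀ K
  0<K[α-[β+c]] : 0ℚ ℚ.< K ℚ.* (α ℚ.- (β ℚ.+ c))
  0<K[α-[β+c]] = ℚP.positive⁻¹ _ {{ℚP.pos*pos⇒pos K {{ℚ.positive 0<K}}
    (α ℚ.- (β ℚ.+ c)) {{ℚ.positive (p<q⇒0<q-p gap)}}}}
  K[α-[β+c]]≡K[α-β]-1 : K ℚ.* (α ℚ.- (β ℚ.+ c)) ≡ K ℚ.* (α ℚ.- β) ℚ.- 1ℚ
  K[α-[β+c]]≡K[α-β]-1 =
    trans (solve 4 (λ K α β c → K :* (α :- (β :+ c)) := K :* (α :- β) :- c :* K) refl K α β c)
          (cong (λ cK → K ℚ.* (α ℚ.- β) ℚ.- cK) (÷₀-*-cancel (toℚ 1) K (≢-sym (ℚP.<⇒≢ 0<K))))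

DB-numerator-bound : ∀ {α β K B R V X Y} → 0ℚ ℚ.≤ β → toℚ 2 ℚ.* β ℚ.≤ α →
  K ℚ.* B ℚ.+ toℚ 2 ℚ.* V ℚ.≤ R ℚ.* V ℚ.+ (toℚ 2 ℚ.* X ℚ.+ Y) → X ℚ.+ Y ℚ.≤ V →
  α ℚ.* X ℚ.+ β ℚ.* Y ℚ.≤ B →
  (K ℚ.* (α ℚ.- β) ℚ.- 1ℚ) ℚ.* B ℚ.≤ R ℚ.* V ℚ.* (α ℚ.- β) ℚ.- α ℚ.* V
DB-numerator-bound {α} {β} {K} {B} {R} {V} {X} {Y} 0≤β 2β≤α counting sizes bound =
  0≤q-p⇒p≤q (subst (0ℚ ℚ.≤_) (sym slack-decomposition)
    (ℚP.+-mono-≤ (ℚP.+-mono-≤ (0≤p*q 0≤α-β (p≤q⇒0≤q-p counting))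
                              (0≤p*q (p≤q⇒0≤q-p 2β≤α) (p≤q⇒0≤q-p sizes)))
                 (p≤q⇒0≤q-p bound)))
  where
  open ℚSolver.+-*-Solver
  0≤α-β : 0ℚ ℚ.≤ α ℚ.- β
  0≤α-β = subst (0ℚ ℚ.≤_) (solve 2 (λ α β → (α :- con (toℚ 2) :* β) :+ β := α :- β) refl α β)
                (ℚP.+-mono-≤ (p≤q⇒0≤q-p 2β≤α) 0≤β)
  slack-decomposition :
    (R ℚ.* V ℚ.* (α ℚ.- β) ℚ.- α ℚ.* V) ℚ.- (K ℚ.* (α ℚ.- β) ℚ.- 1ℚ) ℚ.* B
      ≡ (α ℚ.- β) ℚ.* ((R ℚ.* V ℚ.+ (toℚ 2 ℚ.* X ℚ.+ Y)) ℚ.- (K ℚ.* B ℚ.+ toℚ 2 ℚ.* V))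
        ℚ.+ (α ℚ.- toℚ 2 ℚ.* β) ℚ.* (V ℚ.- (X ℚ.+ Y))
        ℚ.+ (B ℚ.- (α ℚ.* X ℚ.+ β ℚ.* Y))
  slack-decomposition = solve 8 (λ α β K B R V X Y →
    (R :* V :* (α :- β) :- α :* V) :- (K :* (α :- β) :- con 1ℚ) :* B
      := (α :- β) :* ((R :* V :+ (con (toℚ 2) :* X :+ Y)) :- (K :* B :+ con (toℚ 2) :* V))
         :+ (α :- con (toℚ 2) :* β) :* (V :- (X :+ Y))
         :+ (B :- (α :* X :+ β :* Y))) refl α β K B R V X Y

b≤DB : ∀ b k r v x y {α β : ℚ} → 0 < k →
  k * b + 2 * v ≤ r * v + (2 * x + y) → x + y ≤ v →
  0ℚ ℚ.≤ β → toℚ 2 ℚ.* β ℚ.≤ α → β ℚ.+ (toℚ 1 ÷₀ toℚ k) ℚ.< α →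
  α ℚ.* toℚ x ℚ.+ β ℚ.* toℚ y ℚ.≤ toℚ b → toℚ b ℚ.≤ DB v k r α β
b≤DB b k r v x y 0<k counting sizes 0≤β 2β≤α gap bound =
  q*p≤n⇒p≤n÷₀q (DB-denominator-pos 0<K gap)
    (DB-numerator-bound {K = toℚ k} {R = toℚ r} 0≤β 2β≤α counting′ sizes′ bound)
  where
  0<K : 0ℚ ℚ.< toℚ k
  0<K = toℚ-mono-< 0<k
  counting′ : toℚ k ℚ.* toℚ b ℚ.+ toℚ 2 ℚ.* toℚ v
                ℚ.≤ toℚ r ℚ.* toℚ v ℚ.+ (toℚ 2 ℚ.* toℚ x ℚ.+ toℚ y)
  counting′ = subst₂ ℚ._≤_
    (trans (toℚ-+ (k ℕ.* b) _) (cong₂ ℚ._+_ (toℚ-* k b) (toℚ-* 2 v)))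
    (trans (toℚ-+ (r ℕ.* v) _) (cong₂ ℚ._+_ (toℚ-* r v)
      (trans (toℚ-+ (2 ℕ.* x) y) (cong (ℚ._+ toℚ y) (toℚ-* 2 x)))))
    (toℚ-mono-≤ counting)
  sizes′ : toℚ x ℚ.+ toℚ y ℚ.≤ toℚ v
  sizes′ = subst (ℚ._≤ toℚ v) (toℚ-+ x y) (toℚ-mono-≤ sizes)

lemma5p2 : (v k λ′ r d : ℕ) → 1 ℕ.≤ λ′ → 3 ℕ.≤ k → k ℕ.< v →
    λ′ ℕ.* (v ∸ 1) ≡ r ℕ.* (k ∸ 1) ℕ.+ d → d ℕ.< k ∸ 1 →
    (α β : ℚ) → 0ℚ ℚ.≤ α → 0ℚ ℚ.≤ β →
    toℚ 2 ℚ.* β ℚ.≤ α → β ℚ.+ (toℚ 1 ÷₀ toℚ k) ℚ.< α →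
    ((𝒟 : Blocks v) → IsPacking v k λ′ 𝒟 →
      (α ℚ.* toℚ (sizeV k λ′ d 0 𝒟)) ℚ.+ (β ℚ.* toℚ (sizeV k λ′ d 1 𝒟))
        ℚ.≤ toℚ (length 𝒟)) →
    (𝒟 : Blocks v) → IsPacking v k λ′ 𝒟 →
      + length 𝒟 ℤ.≤ floor (DB v k r α β)
lemma5p2 v k λ′ r d _ 3≤k _ division d<k∸1 α β _ 0≤β 2β≤α gap bound 𝒟 packing =
  toℚ≤q⇒≤floor (length 𝒟) (DB v k r α β)
    (b≤DB (length 𝒟) k r v (sizeV k λ′ d 0 𝒟) (sizeV k λ′ d 1 𝒟) (ℕP.≤-trans (s≤s z≤n) 3≤k)
      k*∣𝒟∣+2*v≤r*v+2*∣V₀∣+∣V₁∣ ∣V₀∣+∣V₁∣≤v 0≤β 2β≤α gap (bound 𝒟 packing))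
  where open Deficiency {r = r} packing division d<k∸1
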